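{- Let $c \geq 4$ and let $G_1, G_2, \ldots, G_c$ be directed graphs on a common set of $n$ vertices. If $\sum_{i = 1}^c e(G_i) > \frac{c}{2}n^2$, then there exists a rainbow directed triangle.
   Context: A directed graph $G$ consists of a vertex set $V(G)$ and an edge set $E(G)$ of ordered pairs of distinct vertices (no loops, no multiple edges; both $(u,v)$ and $(v,u)$ may be present). $e(G)=|E(G)|$. The edges of $G_i$ are thought of as having color $i$. A rainbow directed triangle is a triple of distinct vertices $u,v,w$ together with pairwise distinct colors $a,b,d$ such that $(u,v)\in E(G_a)$, $(v,w)\in E(G_b)$, $(w,u)\in E(G_d)$. -}

module Defs where

open import Data.Nat using (ℕ; _+_)
open import Data.Bool using (Bool; true; false)
open import Data.Fin using (Fin)
open import Data.Nat.ListAction using (sum)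
open import Data.List using (List; map; allFin; filterᵇ; length)
open import Data.Product using (_×_; _,_; Σ-syntax; ∃-syntax)
open import Relation.Binary.PropositionalEquality using (_≡_; _≢_)

-- A directed graph on vertex set Fin n: adjacency (u , v) ↦ edge from u to v.
-- No loops; multiple edges impossible by construction; both directions allowed.
record Digraph (n : ℕ) : Set where
  field
    adj    : Fin n → Fin n → Bool
    noLoop : (v : Fin n) → adj v v ≡ false
open Digraph public

e : {n : ℕ} → Digraph n → ℕ
e {n} G = sum (map (λ u → length (filterᵇ (λ v → adj G u v) (allFin n))) (allFin n))

totalEdges : {n c : ℕ} → (Fin c → Digraph n) → ℕ
totalEdges {n} {c} G = sum (map (λ i → e (G i)) (allFin c))

RainbowTriangle : {n c : ℕ} → (Fin c → Digraph n) → Set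
RainbowTriangle {n} {c} G =
  Σ[ u ∈ Fin n ] Σ[ v ∈ Fin n ] Σ[ w ∈ Fin n ] Σ[ a ∈ Fin c ] Σ[ b ∈ Fin c ] Σ[ d ∈ Fin c ]
    ((u ≢ v) × (v ≢ w) × (w ≢ u) × (a ≢ b) × (b ≢ d) × (d ≢ a) ×
     (adj (G a) u v ≡ true) × (adj (G b) v w ≡ true) × (adj (G d) w u ≡ true))

module Submission where

-- Write s p q for the number of colours on the edge (p , q). A rainbow triangle exists as soon as
-- some directed triangle carries at least 1, 2 and 3 colours on its three edges (in some order), so
-- it suffices to show 2 ∑ s ≤ c n² when no triangle does. This is proved for every vertex set U by
-- induction on ∣ U ∣. If some pair carries at least 2 colours in each direction, every third vertex
-- sends total weight at most 2c to the pair, and the pair can be removed. Otherwise every pair has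
-- total weight at most c + 1; call the pairs of weight c + 1 heavy. The heavy neighbours of a vertex u
-- split into out- and in-neighbours, each class spanning only pairs of weight at most 2. Removing a
-- vertex of the larger class at a u of maximal heavy degree costs at most c (∣ U ∣ - 1) + 2, which is
-- within the budget because c ≥ 4.

open import Data.Bool using (Bool; true; false; _∧_; not; if_then_else_)
open import Data.Bool.Properties as B using ()
open import Data.Empty using (⊥)
open import Data.Fin using (Fin; zero; suc; _≟_)
open import Data.Fin.Properties using (any?)
open import Data.List using (allFin; filter; filterᵇ; length; map; tabulate)
open import Data.List.Extrema.Nat using (argmax; argmax-all; f[xs]≤f[argmax])
open import Data.List.Membership.Propositional.Properties using (∈-allFin; ∈-filter⁺)
open import Data.List.Relation.Unary.All as All using ()
open import Data.List.Relation.Unary.All.Properties using (all-filter)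
open import Data.Nat using (ℕ; zero; suc; _+_; _*_; _≤_; _<_; _≥_; _>_; _≤?_; _<ᵇ_; z≤n; s≤s; s≤s⁻¹)
open import Data.Nat.Induction using (<-wellFounded)
open import Data.Nat.ListAction as List using ()
open import Data.Nat.Properties hiding (_≟_)
open import Algebra.Properties.Semiring.Sum +-*-semiring
  using (sum-syntax; ∑-distrib-+; ∑-comm; sum-cong-≗; *-distribˡ-sum)
open import Data.Nat.Tactic.RingSolver using (solve-∀)
open import Data.Product using (_×_; _,_; ∃-syntax; proj₁; uncurry)
open import Data.Sum using (_⊎_; inj₁; inj₂)
open import Function using (_∘_; id)
open import Induction.WellFounded as WF using ()
open import Relation.Binary.Construct.On as On using ()
open import Relation.Binary.PropositionalEquality
open import Relation.Nullary using (Dec; yes; no; ¬_; contradiction)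
open import Relation.Nullary.Decidable using (does; _×-dec_; ¬?)
open import Relation.Nullary.Reflects using (ofʸ; ofⁿ)

open import Defs

-- Finite sums and subsets of Fin n

m+n≤2*m : ∀ {m n} → n ≤ m → m + n ≤ 2 * m
m+n≤2*m {m} n≤m = ≤-trans (+-monoʳ-≤ m n≤m) (≤-reflexive (cong (m +_) (sym (+-identityʳ m))))

⟦_⟧ : Bool → ℕ
⟦ b ⟧ = if b then 1 else 0

∑-mono-≤ : ∀ {n} {f g : Fin n → ℕ} → (∀ i → f i ≤ g i) → ∑[ i < n ] f i ≤ ∑[ i < n ] g i
∑-mono-≤ {zero}  f≤g = z≤n
∑-mono-≤ {suc n} f≤g = +-mono-≤ (f≤g zero) (∑-mono-≤ (f≤g ∘ suc))

∑-const : ∀ n k → ∑[ i < n ] k ≡ n * k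
∑-const zero    k = refl
∑-const (suc n) k = cong (k +_) (∑-const n k)

∑-pos : ∀ {n} (f : Fin n → ℕ) → 1 ≤ ∑[ i < n ] f i → ∃[ i ] 1 ≤ f i
∑-pos {suc n} f 1≤∑ with f zero in eq
... | suc _ = zero , subst (1 ≤_) (sym eq) (s≤s z≤n)
... | zero  with ∑-pos (f ∘ suc) 1≤∑
...   | i , 1≤fi = suc i , 1≤fi

∑-δ : ∀ {n} (v : Fin n) (f : Fin n → ℕ) → ∑[ z < n ] (if does (z ≟ v) then f z else 0) ≡ f v
∑-δ {suc n} zero    f = trans (cong (f zero +_) (trans (∑-const n 0) (*-zeroʳ n))) (+-identityʳ (f zero))
∑-δ {suc n} (suc v) f = ∑-δ v (λ z → f (suc z))

Subsetᵇ : ℕ → Set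
Subsetᵇ n = Fin n → Bool

module _ {n : ℕ} where

  infix 4 _∈_
  _∈_ : Fin n → Subsetᵇ n → Set
  z ∈ U = U z ≡ true

  infixl 6 _-_
  _-_ : Subsetᵇ n → Fin n → Subsetᵇ n
  (U - v) z = U z ∧ not (does (z ≟ v))

  ⁅_⁆ : Fin n → Subsetᵇ n
  ⁅ v ⁆ z = does (z ≟ v)

  restrict : Subsetᵇ n → (Fin n → ℕ) → Fin n → ℕ
  restrict U f z = if U z then f z else 0

  sumOver : Subsetᵇ n → (Fin n → ℕ) → ℕ
  sumOver U f = ∑[ z < n ] restrict U f z

  syntax sumOver U (λ z → e) = ∑[ z ∈ U ] e

  ∣_∣ : Subsetᵇ n → ℕ
  ∣ U ∣ = ∑[ z ∈ U ] 1

  ∈-remove⁻ : ∀ U v {z} → z ∈ U - v → z ∈ U × z ≢ v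
  ∈-remove⁻ U v {z} z∈U-v with U z | z ≟ v
  ... | true | no z≢v = refl , z≢v

  ∈-remove⁺ : ∀ U {v z} → z ∈ U → z ≢ v → z ∈ U - v
  ∈-remove⁺ U {v} {z} z∈U z≢v with z ≟ v
  ... | yes z≡v = contradiction z≡v z≢v
  ... | no _    = cong (_∧ true) z∈U

  sumOver-mono-≤ : ∀ U {f g : Fin n → ℕ} → (∀ z → z ∈ U → f z ≤ g z) →
                   ∑[ z ∈ U ] f z ≤ ∑[ z ∈ U ] g z
  sumOver-mono-≤ U {f} {g} f≤g = ∑-mono-≤ pointwise
    where
    pointwise : ∀ z → restrict U f z ≤ restrict U g z
    pointwise z with U z in z∈U
    ... | true  = f≤g z z∈U
    ... | false = z≤n

  sumOver-cong : ∀ U {f g : Fin n → ℕ} → (∀ z → z ∈ U → f z ≡ g z) →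
                 ∑[ z ∈ U ] f z ≡ ∑[ z ∈ U ] g z
  sumOver-cong U {f} {g} f≡g = sum-cong-≗ pointwise
    where
    pointwise : ∀ z → restrict U f z ≡ restrict U g z
    pointwise z with U z in z∈U
    ... | true  = f≡g z z∈U
    ... | false = refl

  sumOver-distrib-+ : ∀ U (f g : Fin n → ℕ) →
                      ∑[ z ∈ U ] (f z + g z) ≡ ∑[ z ∈ U ] f z + ∑[ z ∈ U ] g z
  sumOver-distrib-+ U f g = trans (sum-cong-≗ pointwise) (∑-distrib-+ (restrict U f) (restrict U g))
    where
    pointwise : ∀ z → restrict U (λ z → f z + g z) z ≡ restrict U f z + restrict U g z
    pointwise z with U z
    ... | true  = refl
    ... | false = refl

  sumOver-*ˡ : ∀ U k (f : Fin n → ℕ) → ∑[ z ∈ U ] (k * f z) ≡ k * ∑[ z ∈ U ] f z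
  sumOver-*ˡ U k f = trans (sum-cong-≗ pointwise) (sym (*-distribˡ-sum k (restrict U f)))
    where
    pointwise : ∀ z → restrict U (λ z → k * f z) z ≡ k * restrict U f z
    pointwise z with U z
    ... | true  = refl
    ... | false = sym (*-zeroʳ k)

  sumOver-const : ∀ U k → ∑[ z ∈ U ] k ≡ k * ∣ U ∣
  sumOver-const U k = trans (sumOver-cong U (λ _ _ → sym (*-identityʳ k))) (sumOver-*ˡ U k (λ _ → 1))

  restrict-remove-≤ : ∀ U v (f : Fin n → ℕ) z →
                      restrict U f z ≤ restrict (U - v) f z + restrict ⁅ v ⁆ f z
  restrict-remove-≤ U v f z with U z | z ≟ v
  ... | true  | yes _ = ≤-refl
  ... | false | yes _ = z≤n
  ... | true  | no _  = m≤m+n (f z) 0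
  ... | false | no _  = z≤n

  restrict-remove : ∀ U {v} (f : Fin n → ℕ) → v ∈ U → ∀ z →
                    restrict U f z ≡ restrict (U - v) f z + restrict ⁅ v ⁆ f z
  restrict-remove U {v} f v∈U z with z ≟ v
  ... | yes refl rewrite v∈U = refl
  ... | no _ with U z
  ...   | true  = sym (+-identityʳ (f z))
  ...   | false = refl

  sum-restrict-remove : ∀ U v (f : Fin n → ℕ) →
    ∑[ z < n ] (restrict (U - v) f z + restrict ⁅ v ⁆ f z) ≡ ∑[ z ∈ U - v ] f z + f v
  sum-restrict-remove U v f =
    trans (∑-distrib-+ (restrict (U - v) f) (restrict ⁅ v ⁆ f)) (cong (∑[ z ∈ U - v ] f z +_) (∑-δ v f))

  sumOver-remove : ∀ U {v} (f : Fin n → ℕ) → v ∈ U → ∑[ z ∈ U ] f z ≡ ∑[ z ∈ U - v ] f z + f v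
  sumOver-remove U {v} f v∈U = trans (sum-cong-≗ (restrict-remove U f v∈U)) (sum-restrict-remove U v f)

  sumOver-remove-≤ : ∀ U v (f : Fin n → ℕ) → ∑[ z ∈ U ] f z ≤ ∑[ z ∈ U - v ] f z + f v
  sumOver-remove-≤ U v f = ≤-trans (∑-mono-≤ (restrict-remove-≤ U v f)) (≤-reflexive (sum-restrict-remove U v f))

  sumOver-pos : ∀ U (f : Fin n → ℕ) → 1 ≤ ∑[ z ∈ U ] f z → ∃[ z ] z ∈ U × 1 ≤ f z
  sumOver-pos U f 1≤∑ with ∑-pos (restrict U f) 1≤∑
  ... | z , 1≤fz with U z in z∈U
  ...   | true = z , z∈U , 1≤fz

  sumOver-empty : ∀ U (f : Fin n → ℕ) → (∀ z → ¬ z ∈ U) → ∑[ z ∈ U ] f z ≡ 0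
  sumOver-empty U f U-empty = trans (sum-cong-≗ pointwise) (trans (∑-const n 0) (*-zeroʳ n))
    where
    pointwise : ∀ z → restrict U f z ≡ 0
    pointwise z with U z in z∈U
    ... | true  = contradiction z∈U (U-empty z)
    ... | false = refl

  sumOver-⟦⟧-pos : ∀ U (K : Subsetᵇ n) → 1 ≤ ∑[ z ∈ U ] ⟦ K z ⟧ → ∃[ z ] z ∈ U × K z ≡ true
  sumOver-⟦⟧-pos U K 1≤count with sumOver-pos U (λ z → ⟦ K z ⟧) 1≤count
  ... | z , z∈U , 1≤⟦Kz⟧ with K z in z∈K
  ...   | true = z , z∈U , z∈K

  ∣∣≤n : ∀ U → ∣ U ∣ ≤ n
  ∣∣≤n U = ≤-trans (∑-mono-≤ restrict≤1) (≤-reflexive (trans (∑-const n 1) (*-identityʳ n)))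
    where
    restrict≤1 : ∀ z → restrict U (λ _ → 1) z ≤ 1
    restrict≤1 z with U z
    ... | true  = ≤-refl
    ... | false = z≤n

  ∣-∣-remove-≥ : ∀ U v {k} → suc k ≤ ∣ U ∣ → k ≤ ∣ U - v ∣
  ∣-∣-remove-≥ U v 1+k≤∣U∣ =
    s≤s⁻¹ (≤-trans 1+k≤∣U∣ (≤-trans (sumOver-remove-≤ U v (λ _ → 1)) (≤-reflexive (+-comm _ 1))))

  ∣∣-pos : ∀ {U} → 1 ≤ ∣ U ∣ → ∃[ z ] z ∈ U
  ∣∣-pos {U} 1≤∣U∣ with sumOver-pos U (λ _ → 1) 1≤∣U∣
  ... | z , z∈U , _ = z , z∈U

  distinct-members : ∀ {P Q R} → 1 ≤ ∣ P ∣ → 2 ≤ ∣ Q ∣ → 3 ≤ ∣ R ∣ →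
    ∃[ a ] ∃[ b ] ∃[ d ] a ∈ P × b ∈ Q × d ∈ R × a ≢ b × b ≢ d × d ≢ a
  distinct-members {P} {Q} {R} 1≤∣P∣ 2≤∣Q∣ 3≤∣R∣
    with ∣∣-pos 1≤∣P∣
  ... | a , a∈P with ∣∣-pos (∣-∣-remove-≥ Q a 2≤∣Q∣)
  ... | b , b∈Q-a with ∣∣-pos (∣-∣-remove-≥ (R - a) b (∣-∣-remove-≥ R a 3≤∣R∣))
  ... | d , d∈R-a-b =
    let b∈Q , b≢a = ∈-remove⁻ Q a b∈Q-a
        d∈R-a , d≢b = ∈-remove⁻ (R - a) b d∈R-a-b
        d∈R , d≢a = ∈-remove⁻ R a d∈R-a
    in a , b , d , a∈P , b∈Q , d∈R , ≢-sym b≢a , ≢-sym d≢b , d≢a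

  maximiser : ∀ {U v₀} (f : Fin n → ℕ) → v₀ ∈ U → ∃[ u ] u ∈ U × (∀ z → z ∈ U → f z ≤ f u)
  maximiser {U} {v₀} f v₀∈U =
    u , argmax-all f v₀∈U (all-filter (λ z → U z B.≟ true) (allFin n)) ,
    λ z z∈U → All.lookup (f[xs]≤f[argmax] v₀ members) (∈-filter⁺ (λ z → U z B.≟ true) (∈-allFin z) z∈U)
    where
    members = filter (λ z → U z B.≟ true) (allFin n)
    u = argmax f v₀ members

  ∣-∣-remove : ∀ U {v} → v ∈ U → ∣ U ∣ ≡ ∣ U - v ∣ + 1
  ∣-∣-remove U = sumOver-remove U (λ _ → 1)

  ∣-∣-remove-< : ∀ U {v} → v ∈ U → ∣ U - v ∣ < ∣ U ∣
  ∣-∣-remove-< U v∈U = ≤-reflexive (sym (trans (∣-∣-remove U v∈U) (+-comm _ 1)))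

-- Weighted digraphs without a (1, 2, 3)-triangle

-- s abstracts the colour multiplicities; no-123 and no-132 are what rainbow-freeness says about them.
module WeightBound {n : ℕ} (c : ℕ) (4≤c : 4 ≤ c) (s : Fin n → Fin n → ℕ)
  (s-irrefl : ∀ p → s p p ≡ 0)
  (s≤c : ∀ p q → s p q ≤ c)
  (no-123 : ∀ p q r → 1 ≤ s p q → 2 ≤ s q r → 3 ≤ s r p → ⊥)
  (no-132 : ∀ p q r → 1 ≤ s p q → 3 ≤ s q r → 2 ≤ s r p → ⊥)
  where

  w : Fin n → Fin n → ℕ
  w p q = s p q + s q p

  weight : Subsetᵇ n → ℕ
  weight U = ∑[ a ∈ U ] ∑[ b ∈ U ] s a b

  deg : Fin n → Subsetᵇ n → ℕ
  deg v U = ∑[ z ∈ U ] w v z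

  Bounded : Subsetᵇ n → Set
  Bounded U = 2 * weight U ≤ c * (∣ U ∣ * ∣ U ∣)

  s-pos⇒≢ : ∀ {p q} → 1 ≤ s p q → p ≢ q
  s-pos⇒≢ {p} 1≤spp refl = contradiction (subst (1 ≤_) (s-irrefl p) 1≤spp) λ ()

  weight-remove : ∀ U {v} → v ∈ U → weight U ≡ weight (U - v) + deg v (U - v)
  weight-remove U {v} v∈U = begin
    ∑[ a ∈ U ] ∑[ b ∈ U ] s a b
      ≡⟨ sumOver-remove U (λ a → ∑[ b ∈ U ] s a b) v∈U ⟩
    ∑[ a ∈ U' ] ∑[ b ∈ U ] s a b + ∑[ b ∈ U ] s v b
      ≡⟨ cong₂ _+_ (sumOver-cong U' (λ a _ → sumOver-remove U (s a) v∈U)) (sumOver-remove U (s v) v∈U) ⟩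
    ∑[ a ∈ U' ] (∑[ b ∈ U' ] s a b + s a v) + (∑[ b ∈ U' ] s v b + s v v)
      ≡⟨ cong₂ _+_ (sumOver-distrib-+ U' (λ a → ∑[ b ∈ U' ] s a b) (λ a → s a v))
                   (cong (∑[ b ∈ U' ] s v b +_) (s-irrefl v)) ⟩
    (weight U' + ∑[ a ∈ U' ] s a v) + (∑[ b ∈ U' ] s v b + 0)
      ≡⟨ shuffle (weight U') (∑[ a ∈ U' ] s a v) (∑[ b ∈ U' ] s v b) ⟩
    weight U' + (∑[ b ∈ U' ] s v b + ∑[ a ∈ U' ] s a v)
      ≡⟨ cong (weight U' +_) (sym (sumOver-distrib-+ U' (s v) (λ a → s a v))) ⟩
    weight U' + deg v U'
      ∎
    where
    open ≡-Reasoning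
    U' = U - v
    shuffle : ∀ x y z → (x + y) + (z + 0) ≡ x + (z + y)
    shuffle = solve-∀

  Removable : Subsetᵇ n → Fin n → Set
  Removable U v = deg v (U - v) ≤ c * ∣ U - v ∣ + 2

  extend-by-vertex : ∀ {U v} → v ∈ U → Removable U v → Bounded (U - v) → Bounded U
  extend-by-vertex {U} {v} v∈U removable bounded = begin
    2 * weight U                              ≡⟨ cong (2 *_) (weight-remove U v∈U) ⟩
    2 * (weight U' + deg v U')                ≡⟨ *-distribˡ-+ 2 (weight U') (deg v U') ⟩
    2 * weight U' + 2 * deg v U'              ≤⟨ +-mono-≤ bounded (*-monoʳ-≤ 2 removable) ⟩
    c * (k * k) + 2 * (c * k + 2)             ≡⟨ cong (c * (k * k) +_) (*-distribˡ-+ 2 (c * k) 2) ⟩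
    c * (k * k) + (2 * (c * k) + 4)           ≤⟨ +-monoʳ-≤ (c * (k * k)) (+-monoʳ-≤ (2 * (c * k)) 4≤c) ⟩
    c * (k * k) + (2 * (c * k) + c)           ≡⟨ square c k ⟩
    c * ((k + 1) * (k + 1))                   ≡⟨ cong (λ m → c * (m * m)) (∣-∣-remove U v∈U) ⟨
    c * (∣ U ∣ * ∣ U ∣)                       ∎
    where
    open ≤-Reasoning
    U' = U - v
    k = ∣ U' ∣
    square : ∀ c k → c * (k * k) + (2 * (c * k) + c) ≡ c * ((k + 1) * (k + 1))
    square = solve-∀

  closing-path≤c : ∀ {a b} z → 2 ≤ s a b → s b z + s z a ≤ c
  closing-path≤c {a} {b} z 2≤sab with s b z ≤? 2 | s z a ≤? 2
  ... | yes sbz≤2 | yes sza≤2 = ≤-trans (+-mono-≤ sbz≤2 sza≤2) 4≤c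
  ... | no sbz≰2  | _         = ≤-trans (+-mono-≤ (s≤c b z) sza≤0) (≤-reflexive (+-identityʳ c))
    where sza≤0 = ≮⇒≥ λ 1≤sza → no-123 z a b 1≤sza 2≤sab (≰⇒> sbz≰2)
  ... | yes _     | no sza≰2  = ≤-trans (+-monoˡ-≤ (s z a) sbz≤0) (s≤c z a)
    where sbz≤0 = ≮⇒≥ λ 1≤sbz → no-132 b z a 1≤sbz (≰⇒> sza≰2) 2≤sab

  w-double≤2c : ∀ {a b} z → 2 ≤ s a b → 2 ≤ s b a → w a z + w b z ≤ c + c
  w-double≤2c {a} {b} z 2≤sab 2≤sba = begin
    (s a z + s z a) + (s b z + s z b)  ≡⟨ regroup (s a z) (s z a) (s b z) (s z b) ⟩
    (s b z + s z a) + (s a z + s z b)  ≤⟨ +-mono-≤ (closing-path≤c z 2≤sab) (closing-path≤c z 2≤sba) ⟩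
    c + c                              ∎
    where
    open ≤-Reasoning
    regroup : ∀ p q r t → (p + q) + (r + t) ≡ (r + q) + (p + t)
    regroup = solve-∀

  extend-by-pair : ∀ {U a b} → a ∈ U → b ∈ U - a → 2 ≤ s a b → 2 ≤ s b a →
                   Bounded (U - a - b) → Bounded U
  extend-by-pair {U} {a} {b} a∈U b∈U' 2≤sab 2≤sba bounded = begin
    2 * weight U
      ≡⟨ cong (2 *_) (trans (weight-remove U a∈U)
                            (cong₂ _+_ (weight-remove U' b∈U') (sumOver-remove U' (w a) b∈U'))) ⟩
    2 * ((weight U'' + deg b U'') + (deg a U'' + w a b))
      ≡⟨ regroup (weight U'') (deg b U'') (deg a U'') (w a b) ⟩
    2 * weight U'' + 2 * (deg a U'' + deg b U'') + 2 * w a b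
      ≤⟨ +-mono-≤ (+-mono-≤ bounded (*-monoʳ-≤ 2 degs≤)) (*-monoʳ-≤ 2 (+-mono-≤ (s≤c a b) (s≤c b a))) ⟩
    c * (k * k) + 2 * ((c + c) * k) + 2 * (c + c)
      ≡⟨ square c k ⟩
    c * ((k + 1 + 1) * (k + 1 + 1))
      ≡⟨ cong (λ m → c * (m * m)) (trans (∣-∣-remove U a∈U) (cong (_+ 1) (∣-∣-remove U' b∈U'))) ⟨
    c * (∣ U ∣ * ∣ U ∣)
      ∎
    where
    open ≤-Reasoning
    U' = U - a
    U'' = U' - b
    k = ∣ U'' ∣
    degs≤ : deg a U'' + deg b U'' ≤ (c + c) * k
    degs≤ = begin
      deg a U'' + deg b U''           ≡⟨ sumOver-distrib-+ U'' (w a) (w b) ⟨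
      ∑[ z ∈ U'' ] (w a z + w b z)     ≤⟨ sumOver-mono-≤ U'' (λ z _ → w-double≤2c z 2≤sab 2≤sba) ⟩
      ∑[ z ∈ U'' ] (c + c)             ≡⟨ sumOver-const U'' (c + c) ⟩
      (c + c) * k                      ∎
    regroup : ∀ x y z t → 2 * ((x + y) + (z + t)) ≡ 2 * x + 2 * (z + y) + 2 * t
    regroup = solve-∀
    square : ∀ c k → c * (k * k) + 2 * ((c + c) * k) + 2 * (c + c) ≡ c * ((k + 1 + 1) * (k + 1 + 1))
    square = solve-∀

  Oriented : Subsetᵇ n → Set
  Oriented U = ∀ {a b} → a ∈ U → b ∈ U → s a b ≤ 1 ⊎ s b a ≤ 1

  Heavy Out In : Fin n → Fin n → Bool
  Heavy v z = c <ᵇ w v z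
  Out   u z = Heavy u z ∧ (1 <ᵇ s u z)
  In    u z = Heavy u z ∧ (1 <ᵇ s z u)

  heavyDeg outDeg inDeg : Fin n → Subsetᵇ n → ℕ
  heavyDeg v U = ∑[ z ∈ U ] ⟦ Heavy v z ⟧
  outDeg   v U = ∑[ z ∈ U ] ⟦ Out v z ⟧
  inDeg    v U = ∑[ z ∈ U ] ⟦ In v z ⟧

  w≤c+heavy : ∀ {v z} → s v z ≤ 1 ⊎ s z v ≤ 1 → w v z ≤ c + ⟦ Heavy v z ⟧
  w≤c+heavy {v} {z} oriented with c <ᵇ w v z | <ᵇ-reflects-< c (w v z) | oriented
  ... | false | ofⁿ w≯c | _          = ≤-trans (≮⇒≥ w≯c) (m≤m+n c 0)
  ... | true  | ofʸ _   | inj₁ svz≤1 = ≤-trans (+-mono-≤ svz≤1 (s≤c z v)) (≤-reflexive (+-comm 1 c))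
  ... | true  | ofʸ _   | inj₂ szv≤1 = +-mono-≤ (s≤c v z) szv≤1

  Out⇒ : ∀ {u z} → Out u z ≡ true → c < w u z × 2 ≤ s u z
  Out⇒ {u} {z} _ with c <ᵇ w u z | <ᵇ-reflects-< c (w u z) | 1 <ᵇ s u z | <ᵇ-reflects-< 1 (s u z)
  ... | true | ofʸ c<w | true | ofʸ 2≤suz = c<w , 2≤suz

  In⇒ : ∀ {u z} → In u z ≡ true → c < w z u × 2 ≤ s z u
  In⇒ {u} {z} _ with c <ᵇ w u z | <ᵇ-reflects-< c (w u z) | 1 <ᵇ s z u | <ᵇ-reflects-< 1 (s z u)
  ... | true | ofʸ c<w | true | ofʸ 2≤szu = subst (c <_) (+-comm (s u z) (s z u)) c<w , 2≤szu

  heavy-forward : ∀ {p q} → s p q ≤ 1 ⊎ s q p ≤ 1 → c < w p q → 2 ≤ s p q → 3 ≤ s p q × 1 ≤ s q p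
  heavy-forward (inj₁ spq≤1) _ 2≤spq = contradiction spq≤1 (<⇒≱ 2≤spq)
  heavy-forward {p} {q} (inj₂ sqp≤1) c<w 2≤spq =
    ≤-trans (≤-trans (n≤1+n 3) 4≤c) c≤spq , 1≤sqp
    where
    c≤spq : c ≤ s p q
    c≤spq = s≤s⁻¹ (≤-trans c<w (≤-trans (+-monoʳ-≤ (s p q) sqp≤1) (≤-reflexive (+-comm (s p q) 1))))
    1≤sqp : 1 ≤ s q p
    1≤sqp = ≮⇒≥ λ sqp<1 → <⇒≱ c<w (≤-trans (+-mono-≤ (s≤c p q) (s≤s⁻¹ sqp<1)) (≤-reflexive (+-identityʳ c)))

  out-arc : ∀ {U u z} → Oriented U → u ∈ U → z ∈ U → Out u z ≡ true → 3 ≤ s u z × 1 ≤ s z u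
  out-arc oriented u∈U z∈U z∈Out = uncurry (heavy-forward (oriented u∈U z∈U)) (Out⇒ z∈Out)

  in-arc : ∀ {U u z} → Oriented U → u ∈ U → z ∈ U → In u z ≡ true → 3 ≤ s z u × 1 ≤ s u z
  in-arc oriented u∈U z∈U z∈In = uncurry (heavy-forward (oriented z∈U u∈U)) (In⇒ z∈In)

  out-clique : ∀ {U u v z} → Oriented U → u ∈ U → v ∈ U → Out u v ≡ true →
               z ∈ U → Out u z ≡ true → w v z ≤ 2
  out-clique oriented u∈U v∈U v∈Out z∈U z∈Out =
    let 3≤suv , 1≤svu = out-arc oriented u∈U v∈U v∈Out
        3≤suz , 1≤szu = out-arc oriented u∈U z∈U z∈Out
    in +-mono-≤ (≮⇒≥ λ 2≤svz → no-132 _ _ _ 1≤szu 3≤suv 2≤svz)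
                (≮⇒≥ λ 2≤szv → no-132 _ _ _ 1≤svu 3≤suz 2≤szv)

  in-clique : ∀ {U u v z} → Oriented U → u ∈ U → v ∈ U → In u v ≡ true →
              z ∈ U → In u z ≡ true → w v z ≤ 2
  in-clique oriented u∈U v∈U v∈In z∈U z∈In =
    let 3≤svu , 1≤suv = in-arc oriented u∈U v∈U v∈In
        3≤szu , 1≤suz = in-arc oriented u∈U z∈U z∈In
    in +-mono-≤ (≮⇒≥ λ 2≤svz → no-123 _ _ _ 1≤suv 2≤svz 3≤szu)
                (≮⇒≥ λ 2≤szv → no-123 _ _ _ 1≤suz 2≤szv 3≤svu)

  heavy-split : ∀ u U → heavyDeg u U ≤ outDeg u U + inDeg u U
  heavy-split u U = begin
    heavyDeg u U                              ≤⟨ sumOver-mono-≤ U (λ z _ → pointwise z) ⟩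
    ∑[ z ∈ U ] (⟦ Out u z ⟧ + ⟦ In u z ⟧)     ≡⟨ sumOver-distrib-+ U (λ z → ⟦ Out u z ⟧) (λ z → ⟦ In u z ⟧) ⟩
    outDeg u U + inDeg u U                    ∎
    where
    open ≤-Reasoning
    pointwise : ∀ z → ⟦ Heavy u z ⟧ ≤ ⟦ Out u z ⟧ + ⟦ In u z ⟧
    pointwise z with c <ᵇ w u z | <ᵇ-reflects-< c (w u z)
                   | 1 <ᵇ s u z | <ᵇ-reflects-< 1 (s u z) | 1 <ᵇ s z u | <ᵇ-reflects-< 1 (s z u)
    ... | false | _       | _     | _       | _     | _       = z≤n
    ... | true  | _       | true  | _       | _     | _       = s≤s z≤n
    ... | true  | _       | false | _       | true  | _       = ≤-refl
    ... | true  | ofʸ c<w | false | ofⁿ suz≱2 | false | ofⁿ szu≱2 =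
      contradiction (≤-trans 4≤c (<⇒≤ (≤-trans c<w (+-mono-≤ (≮⇒≥ suz≱2) (≮⇒≥ szu≱2)))))
                    λ { (s≤s (s≤s ())) }

  deg-bound : ∀ W v (K : Subsetᵇ n) → (∀ {z} → z ∈ W → s v z ≤ 1 ⊎ s z v ≤ 1) →
              (∀ {z} → z ∈ W → K z ≡ true → w v z ≤ 2) →
              heavyDeg v W ≤ 2 * suc (∑[ z ∈ W ] ⟦ K z ⟧) →
              deg v W ≤ c * ∣ W ∣ + 2
  -- Each z in K is charged w v z + 2 ≤ c instead of c + ⟦ Heavy v z ⟧; the 2 per member of K
  -- saved this way pays for the heavy pairs.
  deg-bound W v K oriented clique heavy≤ = +-cancelʳ-≤ (2 * d) _ _ (begin
    deg v W + 2 * d                         ≡⟨ cong (deg v W +_) (sumOver-*ˡ W 2 (λ z → ⟦ K z ⟧)) ⟨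
    deg v W + ∑[ z ∈ W ] (2 * ⟦ K z ⟧)       ≡⟨ sumOver-distrib-+ W (w v) (λ z → 2 * ⟦ K z ⟧) ⟨
    ∑[ z ∈ W ] (w v z + 2 * ⟦ K z ⟧)        ≤⟨ sumOver-mono-≤ W pointwise ⟩
    ∑[ z ∈ W ] (c + ⟦ Heavy v z ⟧)          ≡⟨ sumOver-distrib-+ W (λ _ → c) (λ z → ⟦ Heavy v z ⟧) ⟩
    ∑[ z ∈ W ] c + heavyDeg v W             ≤⟨ +-mono-≤ (≤-reflexive (sumOver-const W c)) heavy≤ ⟩
    c * ∣ W ∣ + 2 * suc d                   ≡⟨ regroup (c * ∣ W ∣) d ⟩
    c * ∣ W ∣ + 2 + 2 * d                   ∎)
    where
    open ≤-Reasoning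
    d = ∑[ z ∈ W ] ⟦ K z ⟧
    pointwise : ∀ z → z ∈ W → w v z + 2 * ⟦ K z ⟧ ≤ c + ⟦ Heavy v z ⟧
    pointwise z z∈W with K z in z∈K
    ... | true  = ≤-trans (≤-trans (+-monoˡ-≤ 2 (clique z∈W z∈K)) 4≤c) (m≤m+n c _)
    ... | false = ≤-trans (≤-reflexive (+-identityʳ (w v z))) (w≤c+heavy (oriented z∈W))
    regroup : ∀ x d → x + 2 * suc d ≡ x + 2 + 2 * d
    regroup = solve-∀

  heavyDeg-remove-≤ : ∀ U {v} → v ∈ U → heavyDeg v (U - v) ≤ heavyDeg v U
  heavyDeg-remove-≤ U {v} v∈U =
    ≤-trans (m≤m+n _ _) (≤-reflexive (sym (sumOver-remove U (λ z → ⟦ Heavy v z ⟧) v∈U)))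

  removable-if-light : ∀ {U v} → Oriented U → v ∈ U → heavyDeg v U ≤ 2 → Removable U v
  removable-if-light {U} {v} oriented v∈U light =
    deg-bound (U - v) v (λ _ → false) (λ z∈U-v → oriented v∈U (proj₁ (∈-remove⁻ U v z∈U-v))) (λ _ ())
              (≤-trans (heavyDeg-remove-≤ U v∈U) (≤-trans light (*-monoʳ-≤ 2 (s≤s z≤n))))

  removable-via : ∀ {U v} (K : Subsetᵇ n) → Oriented U → v ∈ U → K v ≡ true →
                  (∀ {z} → z ∈ U → K z ≡ true → w v z ≤ 2) →
                  heavyDeg v U ≤ 2 * ∑[ z ∈ U ] ⟦ K z ⟧ → Removable U v
  removable-via {U} {v} K oriented v∈U v∈K clique heavy≤ =
    deg-bound (U - v) v K (λ z∈U-v → oriented v∈U (proj₁ (∈-remove⁻ U v z∈U-v)))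
                          (λ z∈U-v → clique (proj₁ (∈-remove⁻ U v z∈U-v)))
                          (begin
      heavyDeg v (U - v)                   ≤⟨ heavyDeg-remove-≤ U v∈U ⟩
      heavyDeg v U                         ≤⟨ heavy≤ ⟩
      2 * ∑[ z ∈ U ] ⟦ K z ⟧               ≡⟨ cong (2 *_) (sumOver-remove U (λ z → ⟦ K z ⟧) v∈U) ⟩
      2 * (∑[ z ∈ U - v ] ⟦ K z ⟧ + ⟦ K v ⟧) ≡⟨ cong (λ b → 2 * (∑[ z ∈ U - v ] ⟦ K z ⟧ + ⟦ b ⟧)) v∈K ⟩
      2 * (∑[ z ∈ U - v ] ⟦ K z ⟧ + 1)     ≡⟨ cong (2 *_) (+-comm _ 1) ⟩
      2 * suc (∑[ z ∈ U - v ] ⟦ K z ⟧)     ∎)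
    where open ≤-Reasoning

  oriented-removable : ∀ {U v₀} → v₀ ∈ U → Oriented U → ∃[ v ] v ∈ U × Removable U v
  oriented-removable {U} {v₀} v₀∈U oriented
    with maximiser (λ z → heavyDeg z U) v₀∈U
  ... | u , u∈U , maximal with inDeg u U ≤? outDeg u U | 1 ≤? outDeg u U
  ...   | yes in≤out | yes 1≤out =
    let v , v∈U , v∈Out = sumOver-⟦⟧-pos U (Out u) 1≤out
    in v , v∈U , removable-via (Out u) oriented v∈U v∈Out (out-clique oriented u∈U v∈U v∈Out)
                   (≤-trans (maximal v v∈U) (≤-trans (heavy-split u U) (m+n≤2*m in≤out)))
  ...   | yes in≤out | no 1≰out =
    let out≤0 = ≮⇒≥ 1≰out
    in v₀ , v₀∈U , removable-if-light oriented v₀∈U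
                     (≤-trans (maximal v₀ v₀∈U) (≤-trans (heavy-split u U)
                       (≤-trans (+-mono-≤ out≤0 (≤-trans in≤out out≤0)) z≤n)))
  ...   | no in≰out | _ =
    let out<in = ≰⇒> in≰out
        v , v∈U , v∈In = sumOver-⟦⟧-pos U (In u) (≤-trans (s≤s z≤n) out<in)
    in v , v∈U , removable-via (In u) oriented v∈U v∈In (in-clique oriented u∈U v∈U v∈In)
                   (≤-trans (maximal v v∈U) (≤-trans (heavy-split u U)
                     (≤-trans (≤-reflexive (+-comm (outDeg u U) _)) (m+n≤2*m (<⇒≤ out<in)))))

  DoublePair : Subsetᵇ n → Set
  DoublePair U = ∃[ a ] ∃[ b ] a ∈ U × b ∈ U × 2 ≤ s a b × 2 ≤ s b a

  double-pair? : ∀ U → Dec (DoublePair U)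
  double-pair? U = any? λ a → any? λ b →
    (U a B.≟ true) ×-dec (U b B.≟ true) ×-dec (2 ≤? s a b) ×-dec (2 ≤? s b a)

  ¬double⇒oriented : ∀ {U} → ¬ DoublePair U → Oriented U
  ¬double⇒oriented {U} no-double {a} {b} a∈U b∈U with 2 ≤? s a b | 2 ≤? s b a
  ... | yes 2≤sab | yes 2≤sba = contradiction (a , b , a∈U , b∈U , 2≤sab , 2≤sba) no-double
  ... | no sab≱2  | _         = inj₁ (≮⇒≥ sab≱2)
  ... | yes _     | no sba≱2  = inj₂ (≮⇒≥ sba≱2)

  empty-bounded : ∀ {U} → (∀ z → ¬ z ∈ U) → Bounded U
  empty-bounded {U} U-empty =
    ≤-trans (≤-reflexive (cong (2 *_) (sumOver-empty U (λ a → ∑[ b ∈ U ] s a b) U-empty))) z≤n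

  bounded : ∀ U → Bounded U
  bounded = WF.All.wfRec (On.wellFounded ∣_∣ <-wellFounded) _ Bounded step
    where
    step : ∀ U → (∀ {V} → ∣ V ∣ < ∣ U ∣ → Bounded V) → Bounded U
    step U ih with any? (λ v → U v B.≟ true)
    ... | no U-empty = empty-bounded λ z z∈U → U-empty (z , z∈U)
    ... | yes (v₀ , v₀∈U) with double-pair? U
    ...   | yes (a , b , a∈U , b∈U , 2≤sab , 2≤sba) =
      let b∈U-a = ∈-remove⁺ U b∈U (s-pos⇒≢ (≤-trans (s≤s z≤n) 2≤sba))
      in extend-by-pair a∈U b∈U-a 2≤sab 2≤sba
           (ih (<-trans (∣-∣-remove-< (U - a) b∈U-a) (∣-∣-remove-< U a∈U)))
    ...   | no no-double =
      let v , v∈U , removable = oriented-removable v₀∈U (¬double⇒oriented no-double)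
      in extend-by-vertex v∈U removable (ih (∣-∣-remove-< U v∈U))

  weight-bound : 2 * ∑[ p < n ] ∑[ q < n ] s p q ≤ c * (n * n)
  weight-bound = subst (λ m → 2 * ∑[ p < n ] ∑[ q < n ] s p q ≤ c * (m * m))
                       (trans (∑-const n 1) (*-identityʳ n)) (bounded (λ _ → true))

-- Colour multiplicities

sum-map-tabulate : ∀ {A : Set} {n} (f : Fin n → A) (g : A → ℕ) →
                   List.sum (map g (tabulate f)) ≡ ∑[ i < n ] g (f i)
sum-map-tabulate {n = zero}  f g = refl
sum-map-tabulate {n = suc n} f g = cong (g (f zero) +_) (sum-map-tabulate (λ i → f (suc i)) g)

length-filterᵇ-tabulate : ∀ {A : Set} {n} (f : Fin n → A) (p : A → Bool) →
                          length (filterᵇ p (tabulate f)) ≡ ∑[ i < n ] ⟦ p (f i) ⟧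
length-filterᵇ-tabulate {n = zero}  f p = refl
length-filterᵇ-tabulate {n = suc n} f p with p (f zero)
... | true  = cong suc (length-filterᵇ-tabulate (λ i → f (suc i)) p)
... | false = length-filterᵇ-tabulate (λ i → f (suc i)) p

module _ {c n : ℕ} (G : Fin c → Digraph n) where

  colours : Fin n → Fin n → Subsetᵇ c
  colours p q i = adj (G i) p q

  mult : Fin n → Fin n → ℕ
  mult p q = ∣ colours p q ∣

  edge⇒≢ : ∀ {i p q} → adj (G i) p q ≡ true → p ≢ q
  edge⇒≢ {i} {p} edge refl = contradiction (trans (sym edge) (noLoop (G i) p)) λ ()

  mult-irrefl : ∀ p → mult p p ≡ 0
  mult-irrefl p = sumOver-empty (colours p p) (λ _ → 1) λ _ loop → edge⇒≢ loop refl

  rainbow : ∀ {p q r a b d} → a ∈ colours p q → b ∈ colours q r → d ∈ colours r p →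
            a ≢ b → b ≢ d → d ≢ a → RainbowTriangle G
  rainbow {p} {q} {r} {a} {b} {d} pq qr rp a≢b b≢d d≢a =
    p , q , r , a , b , d , edge⇒≢ pq , edge⇒≢ qr , edge⇒≢ rp , a≢b , b≢d , d≢a , pq , qr , rp

  rainbow-123 : ∀ p q r → 1 ≤ mult p q → 2 ≤ mult q r → 3 ≤ mult r p → RainbowTriangle G
  rainbow-123 p q r 1≤pq 2≤qr 3≤rp =
    let a , b , d , pq , qr , rp , a≢b , b≢d , d≢a = distinct-members 1≤pq 2≤qr 3≤rp
    in rainbow pq qr rp a≢b b≢d d≢a

  rainbow-132 : ∀ p q r → 1 ≤ mult p q → 3 ≤ mult q r → 2 ≤ mult r p → RainbowTriangle G
  rainbow-132 p q r 1≤pq 3≤qr 2≤rp =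
    let a , d , b , pq , rp , qr , a≢d , d≢b , b≢a = distinct-members 1≤pq 2≤rp 3≤qr
    in rainbow pq qr rp (≢-sym b≢a) (≢-sym d≢b) (≢-sym a≢d)

  rainbow? : Dec (RainbowTriangle G)
  rainbow? =
    any? λ u → any? λ v → any? λ w → any? λ a → any? λ b → any? λ d →
      ¬? (u ≟ v) ×-dec ¬? (v ≟ w) ×-dec ¬? (w ≟ u) ×-dec
      ¬? (a ≟ b) ×-dec ¬? (b ≟ d) ×-dec ¬? (d ≟ a) ×-dec
      (adj (G a) u v B.≟ true) ×-dec (adj (G b) v w B.≟ true) ×-dec (adj (G d) w u B.≟ true)

  totalEdges≡∑mult : totalEdges G ≡ ∑[ p < n ] ∑[ q < n ] mult p q
  totalEdges≡∑mult = begin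
    totalEdges G                                     ≡⟨ sum-map-tabulate id (λ i → e (G i)) ⟩
    ∑[ i < c ] e (G i)                               ≡⟨ sum-cong-≗ edges ⟩
    ∑[ i < c ] ∑[ p < n ] ∑[ q < n ] ⟦ adj (G i) p q ⟧ ≡⟨ ∑-comm (λ i p → ∑[ q < n ] ⟦ adj (G i) p q ⟧) ⟩
    ∑[ p < n ] ∑[ i < c ] ∑[ q < n ] ⟦ adj (G i) p q ⟧ ≡⟨ sum-cong-≗ (λ p → ∑-comm (λ i q → ⟦ adj (G i) p q ⟧)) ⟩
    ∑[ p < n ] ∑[ q < n ] mult p q                   ∎
    where
    open ≡-Reasoning
    edges : ∀ i → e (G i) ≡ ∑[ p < n ] ∑[ q < n ] ⟦ adj (G i) p q ⟧
    edges i = trans (sum-map-tabulate id (λ p → length (filterᵇ (adj (G i) p) (allFin n))))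
                    (sum-cong-≗ λ p → length-filterᵇ-tabulate id (adj (G i) p))

theorem5 : (c n : ℕ) → c ≥ 4 → (G : Fin c → Digraph n) →
  2 * totalEdges G > c * (n * n) → RainbowTriangle G
theorem5 c n 4≤c G many-edges with rainbow? G
... | yes rainbow-triangle = rainbow-triangle
... | no  rainbow-free     = contradiction many-edges (≤⇒≯ few-edges)
  where
  open WeightBound c 4≤c (mult G) (mult-irrefl G) (λ p q → ∣∣≤n (colours G p q))
         (λ p q r 1≤pq 2≤qr 3≤rp → rainbow-free (rainbow-123 G p q r 1≤pq 2≤qr 3≤rp))
         (λ p q r 1≤pq 3≤qr 2≤rp → rainbow-free (rainbow-132 G p q r 1≤pq 3≤qr 2≤rp))
  few-edges : 2 * totalEdges G ≤ c * (n * n)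
  few-edges = subst (λ m → 2 * m ≤ c * (n * n)) (sym (totalEdges≡∑mult G)) weight-bound
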